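{- Let $r$ be a positive integer, let $G$ be a $K_{3,r}$-minor-free graph, and let $I_s,I_t$ be independent sets of $G$ with $|I_s|=|I_t|=k$. Then $|\mathcal{C}_3|\le (r-1)N_3(G)$.
   Context: Let $X:=I_s\cup I_t$. For $Y\subseteq X$, let $\mathcal{C}_Y:=\{v\in V(G)\setminus X : N(v)\cap X=Y\}$. Let $\mathcal{C}_3$ be the union of all $\mathcal{C}_Y$ with $|Y|\ge 3$, and let $N_3(G)$ be the number of sets $Y\subseteq X$ with $|Y|\ge 3$ and $\mathcal{C}_Y\neq\emptyset$. -}

module Defs where

open import Data.Nat using (ℕ; zero; suc; _+_; _≤_; _<ᵇ_)
open import Data.Nat.Properties using (_≤?_)
open import Data.Bool using (Bool; true; false; _xor_)
open import Data.Bool.Properties using (xor-same) renaming (_≟_ to _≟ᵇ_)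
open import Data.Fin using (Fin; toℕ)
open import Data.Fin.Properties using (any?)
open import Data.Fin.Subset using (Subset; _∈_; _∉_; _∪_; _∩_; _⊆_; ∣_∣; inside; outside)
open import Data.Fin.Subset.Properties using (_∈?_; _⊆?_)
open import Data.Vec using (Vec; []; _∷_; tabulate)
open import Data.Vec.Properties using (≡-dec)
open import Data.List using (List; []; _∷_; _++_; map; filter; length; allFin)
open import Data.Maybe using (Maybe; just)
open import Data.Product using (Σ; ∃; _×_; _,_)
open import Relation.Nullary using (¬_; Dec)
open import Relation.Nullary.Decidable using (_×-dec_; ¬?)
open import Relation.Binary.PropositionalEquality using (_≡_; refl)

record Graph (n : ℕ) : Set where
  field
    E     : Fin n → Fin n → Bool
    sym   : ∀ u v → E u v ≡ E v u
    irrefl : ∀ v → E v v ≡ false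
open Graph public

-- Complete bipartite graph K_{a,b} on Fin (a + b):
-- vertices with index < a form one side, the rest the other side.

side : ∀ {m} → ℕ → Fin m → Bool
side a i = toℕ i <ᵇ a

xor-comm′ : ∀ x y → x xor y ≡ y xor x
xor-comm′ false false = refl
xor-comm′ false true  = refl
xor-comm′ true  false = refl
xor-comm′ true  true  = refl

K : (a b : ℕ) → Graph (a + b)
K a b = record
  { E      = λ i j → side a i xor side a j
  ; sym    = λ i j → xor-comm′ (side a i) (side a j)
  ; irrefl = λ i → xor-same (side a i)
  }

-- A minor model of H (on Fin m) in G (on Fin n) is a partial map
-- β : Fin n → Maybe (Fin m) (β v ≡ just h means v lies in branch set B_h;
-- branch sets are thus automatically pairwise disjoint) such that every
-- B_h is nonempty and induces a connected subgraph of G, and for every edge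
-- hh' of H there is an edge of G between B_h and B_h'.

data WalkIn {n m} (G : Graph n) (β : Fin n → Maybe (Fin m)) (h : Fin m)
            : Fin n → Fin n → Set where
  [_]  : ∀ {u} → β u ≡ just h → WalkIn G β h u u
  step : ∀ {u w v} → β u ≡ just h → E G u w ≡ true →
         WalkIn G β h w v → WalkIn G β h u v

record MinorModel {n m} (G : Graph n) (H : Graph m) : Set where
  field
    β         : Fin n → Maybe (Fin m)
    nonempty  : ∀ h → ∃ λ v → β v ≡ just h
    connected : ∀ h u v → β u ≡ just h → β v ≡ just h → WalkIn G β h u v
    edges     : ∀ h h′ → E H h h′ ≡ true →
                Σ (Fin n) λ u → Σ (Fin n) λ v →
                  β u ≡ just h × β v ≡ just h′ × E G u v ≡ true

HasMinor : ∀ {n m} → Graph n → Graph m → Set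
HasMinor G H = MinorModel G H

MinorFree : ∀ {n m} → Graph n → Graph m → Set
MinorFree G H = ¬ HasMinor G H

Independent : ∀ {n} → Graph n → Subset n → Set
Independent G I = ∀ u v → u ∈ I → v ∈ I → E G u v ≡ false

N : ∀ {n} → Graph n → Fin n → Subset n
N G v = tabulate (λ u → E G v u)

allSubsets : ∀ n → List (Subset n)
allSubsets zero    = [] ∷ []
allSubsets (suc n) = map (outside ∷_) (allSubsets n) ++ map (inside ∷_) (allSubsets n)

module _ {n} (G : Graph n) (Is It : Subset n) where

  X : Subset n
  X = Is ∪ It

  InC : Subset n → Fin n → Set
  InC Y v = v ∉ X × (N G v ∩ X) ≡ Y

  inC? : ∀ Y v → Dec (InC Y v)
  inC? Y v = ¬? (v ∈? X) ×-dec ≡-dec _≟ᵇ_ (N G v ∩ X) Y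

  -- C_3 = ⋃_{|Y| ≥ 3} C_Y  = {v ∉ X : |N(v) ∩ X| ≥ 3}, as a list of vertices
  C3 : List (Fin n)
  C3 = filter (λ v → ¬? (v ∈? X) ×-dec (3 ≤? ∣ N G v ∩ X ∣)) (allFin n)

  Ys3 : List (Subset n)
  Ys3 = filter (λ Y → (Y ⊆? X) ×-dec (3 ≤? ∣ Y ∣) ×-dec any? (inC? Y)) (allSubsets n)

  N3 : ℕ
  N3 = length Ys3

-- Send every v ∈ C₃ to its attachment N(v) ∩ X; the image lies among the N₃(G) sets Y
-- counted by N₃, so it suffices that every fibre C_Y (|Y| ≥ 3) has fewer than r elements.
-- Otherwise three vertices of Y together with r vertices of C_Y span a K_{3,r} subgraph, and a
-- subgraph is a minor whose branch sets are singletons.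
module Submission where

open import Defs hiding (sym)
open import Data.Nat using (ℕ; zero; suc; _≤_; _<_; _*_; _∸_; _+_; z≤n; s≤s)
open import Data.Nat.Properties using (_<?_; _≤?_; ≤-trans; +-mono-≤; +-suc; *-suc; ≮⇒≥; ∸-monoˡ-≤; module ≤-Reasoning)
open import Data.Bool using (true; false; _xor_)
open import Data.Bool.Properties using () renaming (_≟_ to _≟ᵇ_)
open import Data.Fin using (Fin; zero; suc; _↑ˡ_; _↑ʳ_; splitAt; join)
open import Data.Fin.Properties using (any?; suc-injective; join-splitAt; +↔⊎) renaming (_≟_ to _≟ᶠ_)
open import Data.Fin.Subset using (Subset; ∣_∣; _∈_; _∉_; _∩_)
open import Data.Fin.Subset.Properties using (p∩q⊆p; p∩q⊆q; _∈?_; _⊆?_)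
open import Data.Vec using ([]; _∷_; here; there)
open import Data.Vec.Properties using (≡-dec; []=⇒lookup; lookup∘tabulate)
open import Data.List using (List; []; _∷_; length; filter; map; allFin)
open import Data.List.Properties using (length-map)
open import Data.List.Membership.Propositional using () renaming (_∈_ to _∈ᴸ_)
open import Data.List.Membership.Propositional.Properties using (∈-filter⁺; ∈-filter⁻; ∈-map⁺; ∈-map⁻; ∈-++⁺ˡ; ∈-++⁺ʳ)
open import Data.List.Relation.Unary.Any using (here; there)
import Data.List.Relation.Unary.All as All
open import Data.List.Relation.Unary.AllPairs using ([]; _∷_)
open import Data.List.Relation.Unary.Unique.Propositional using (Unique)
import Data.List.Relation.Unary.Unique.Propositional.Properties as Unique
import Data.List.Relation.Binary.Sublist.Propositional.Properties as Sublist
open import Data.Maybe using (Maybe; just; nothing)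
open import Data.Product using (Σ; _×_; _,_; proj₁; proj₂)
open import Data.Sum using (inj₁; inj₂; [_,_]′)
open import Level using (0ℓ)
open import Function using (_∘_; Injective; Injection)
open import Function.Properties.Inverse using (↔⇒↣)
open import Relation.Nullary using (yes; no; contradiction)
open import Relation.Nullary.Decidable using (_×-dec_; ¬?)
open import Relation.Unary using (Pred; Decidable)
open import Relation.Unary.Properties using (∁?)
open import Relation.Binary using (DecidableEquality)
open import Relation.Binary.PropositionalEquality using (_≡_; _≢_; refl; sym; trans; cong; subst; subst₂)

length-filter+length-filter-∁ : ∀ {A : Set} {P : Pred A 0ℓ} (P? : Decidable P) (xs : List A) →
  length (filter P? xs) + length (filter (∁? P?) xs) ≡ length xs
length-filter+length-filter-∁ P? [] = refl
length-filter+length-filter-∁ P? (x ∷ xs) with P? x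
... | yes _ = cong suc (length-filter+length-filter-∁ P? xs)
... | no _  = trans (+-suc _ _) (cong suc (length-filter+length-filter-∁ P? xs))

module _ {A B : Set} (_≟_ : DecidableEquality B) (f : A → B) where

  fibre : B → List A → List A
  fibre y = filter (λ x → f x ≟ y)

  pigeonhole : ∀ b ys xs → (∀ {x} → x ∈ᴸ xs → f x ∈ᴸ ys) →
               (∀ {y} → y ∈ᴸ ys → length (fibre y xs) ≤ b) →
               length xs ≤ b * length ys
  pigeonhole b [] [] _ _ = z≤n
  pigeonhole b [] (x ∷ xs) f∈ _ with () ← f∈ (here refl)
  pigeonhole b (y ∷ ys) xs f∈ bound = begin
    length xs                           ≡⟨ sym (length-filter+length-filter-∁ (λ x → f x ≟ y) xs) ⟩
    length (fibre y xs) + length rest   ≤⟨ +-mono-≤ (bound (here refl)) (pigeonhole b ys rest f∈′ bound′) ⟩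
    b + b * length ys                   ≡⟨ sym (*-suc b _) ⟩
    b * length (y ∷ ys)                 ∎
    where
      open ≤-Reasoning
      rest : List A
      rest = filter (∁? (λ x → f x ≟ y)) xs
      f∈′ : ∀ {x} → x ∈ᴸ rest → f x ∈ᴸ ys
      f∈′ x∈rest with ∈-filter⁻ (∁? (λ x → f x ≟ y)) x∈rest
      ... | x∈xs , fx≢y with f∈ x∈xs
      ...   | here fx≡y    = contradiction fx≡y fx≢y
      ...   | there fx∈ys  = fx∈ys
      bound′ : ∀ {y′} → y′ ∈ᴸ ys → length (fibre y′ rest) ≤ b
      bound′ y′∈ys = ≤-trans
        (Sublist.length-mono-≤ (Sublist.filter⁺ _ _ (λ { refl p → p }) (Sublist.filter-⊆ _ xs)))
        (bound (there y′∈ys))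

distinct-elements : ∀ {A : Set} k (xs : List A) → Unique xs → k ≤ length xs →
  Σ (Fin k → A) λ g → Injective _≡_ _≡_ g × (∀ i → g i ∈ᴸ xs)
distinct-elements zero    xs       _              _         = (λ ()) , (λ {}) , λ ()
distinct-elements (suc k) (x ∷ xs) (x∉xs ∷ uniq) (s≤s k≤) with distinct-elements k xs uniq k≤
... | g , g-inj , g∈ = g′ , g′-inj , g′∈
  where
    g′ : Fin (suc k) → _
    g′ zero    = x
    g′ (suc i) = g i
    g′-inj : Injective _≡_ _≡_ g′
    g′-inj {zero}  {zero}  _ = refl
    g′-inj {zero}  {suc j} e = contradiction e (All.lookup x∉xs (g∈ j))
    g′-inj {suc i} {zero}  e = contradiction (sym e) (All.lookup x∉xs (g∈ i))
    g′-inj {suc i} {suc j} e = cong suc (g-inj e)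
    g′∈ : ∀ i → g′ i ∈ᴸ (x ∷ xs)
    g′∈ zero    = here refl
    g′∈ (suc i) = there (g∈ i)

elements : ∀ {n} → Subset n → List (Fin n)
elements []          = []
elements (true ∷ p)  = zero ∷ map suc (elements p)
elements (false ∷ p) = map suc (elements p)

length-elements : ∀ {n} (p : Subset n) → length (elements p) ≡ ∣ p ∣
length-elements []          = refl
length-elements (true ∷ p)  = cong suc (trans (length-map suc (elements p)) (length-elements p))
length-elements (false ∷ p) = trans (length-map suc (elements p)) (length-elements p)

∈-elements⁻ : ∀ {n} (p : Subset n) {x} → x ∈ᴸ elements p → x ∈ p
∈-elements⁻ (true ∷ p) (here refl) = here
∈-elements⁻ (true ∷ p) (there x∈) with ∈-map⁻ suc x∈
... | _ , x∈p , refl = there (∈-elements⁻ p x∈p)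
∈-elements⁻ (false ∷ p) x∈ with ∈-map⁻ suc x∈
... | _ , x∈p , refl = there (∈-elements⁻ p x∈p)

elements-unique : ∀ {n} (p : Subset n) → Unique (elements p)
elements-unique []          = []
elements-unique (true ∷ p)  = All.tabulate zero∉ ∷ Unique.map⁺ suc-injective (elements-unique p)
  where
    zero∉ : ∀ {y} → y ∈ᴸ map suc (elements p) → zero ≢ y
    zero∉ y∈ with ∈-map⁻ suc y∈
    zero∉ y∈ | _ , _ , refl = λ ()
elements-unique (false ∷ p) = Unique.map⁺ suc-injective (elements-unique p)

allSubsets-complete : ∀ {n} (p : Subset n) → p ∈ᴸ allSubsets n
allSubsets-complete []          = here refl
allSubsets-complete (false ∷ p) = ∈-++⁺ˡ (∈-map⁺ (false ∷_) (allSubsets-complete p))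
allSubsets-complete {suc n} (true ∷ p) =
  ∈-++⁺ʳ (map (false ∷_) (allSubsets n)) (∈-map⁺ (true ∷_) (allSubsets-complete p))

module _ {m n} (φ : Fin m → Fin n) where

  preimage : Fin n → Maybe (Fin m)
  preimage v with any? (λ i → φ i ≟ᶠ v)
  ... | yes (i , _) = just i
  ... | no _        = nothing

  preimage-sound : ∀ {v i} → preimage v ≡ just i → φ i ≡ v
  preimage-sound {v} e with any? (λ i → φ i ≟ᶠ v)
  preimage-sound refl | yes (_ , φi≡v) = φi≡v

  preimage-image : Injective _≡_ _≡_ φ → ∀ i → preimage (φ i) ≡ just i
  preimage-image φ-inj i with any? (λ j → φ j ≟ᶠ φ i)
  ... | yes (j , φj≡φi) = cong just (φ-inj φj≡φi)
  ... | no ∄j           = contradiction (i , refl) ∄j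

embedding⇒minor : ∀ {n m} (G : Graph n) (H : Graph m) (φ : Fin m → Fin n) →
  Injective _≡_ _≡_ φ → (∀ i j → E H i j ≡ true → E G (φ i) (φ j) ≡ true) → HasMinor G H
embedding⇒minor G H φ φ-inj φ-edge = record
  { β         = preimage φ
  ; nonempty  = λ h → φ h , preimage-image φ φ-inj h
  ; connected = λ h u v u↦h v↦h →
      subst (WalkIn G (preimage φ) h u)
        (trans (sym (preimage-sound φ u↦h)) (preimage-sound φ v↦h)) [ u↦h ]
  ; edges     = λ h h′ e →
      φ h , φ h′ , preimage-image φ φ-inj h , preimage-image φ φ-inj h′ , φ-edge h h′ e
  }

side-↑ˡ : ∀ {a} (x : Fin a) b → side a (x ↑ˡ b) ≡ true
side-↑ˡ zero    b = refl
side-↑ˡ (suc x) b = side-↑ˡ x b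

side-↑ʳ : ∀ a {b} (y : Fin b) → side a (a ↑ʳ y) ≡ false
side-↑ʳ zero    y = refl
side-↑ʳ (suc a) y = side-↑ʳ a y

[,]-injective : ∀ {A B C : Set} {f : A → C} {g : B → C} →
  Injective _≡_ _≡_ f → Injective _≡_ _≡_ g → (∀ x y → f x ≢ g y) →
  Injective _≡_ _≡_ [ f , g ]′
[,]-injective f-inj g-inj f≢g {inj₁ x} {inj₁ x′} e = cong inj₁ (f-inj e)
[,]-injective f-inj g-inj f≢g {inj₁ x} {inj₂ y}  e = contradiction e (f≢g x y)
[,]-injective f-inj g-inj f≢g {inj₂ y} {inj₁ x}  e = contradiction (sym e) (f≢g x y)
[,]-injective f-inj g-inj f≢g {inj₂ y} {inj₂ y′} e = cong inj₂ (g-inj e)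

biclique⇒minor : ∀ {n a b} (G : Graph n) (f : Fin a → Fin n) (g : Fin b → Fin n) →
  Injective _≡_ _≡_ f → Injective _≡_ _≡_ g → (∀ x y → f x ≢ g y) →
  (∀ x y → E G (f x) (g y) ≡ true) → HasMinor G (K a b)
biclique⇒minor {a = a} {b} G f g f-inj g-inj f≢g adj =
  embedding⇒minor G (K a b) ([ f , g ]′ ∘ splitAt a)
    (Injection.injective (↔⇒↣ (+↔⊎ {a} {b})) ∘ [,]-injective f-inj g-inj f≢g)
    λ i j e → edge (splitAt a i) (splitAt a j)
      (subst₂ (λ i j → E (K a b) i j ≡ true) (sym (join-splitAt a b i)) (sym (join-splitAt a b j)) e)
  where
    edge : ∀ s t → E (K a b) (join a b s) (join a b t) ≡ true →
           E G ([ f , g ]′ s) ([ f , g ]′ t) ≡ true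
    edge (inj₁ x) (inj₂ y) _ = adj x y
    edge (inj₂ y) (inj₁ x) _ = trans (Graph.sym G (g y) (f x)) (adj x y)
    edge (inj₁ x) (inj₁ x′) e =
      contradiction (subst₂ (λ p q → p xor q ≡ true) (side-↑ˡ x b) (side-↑ˡ x′ b) e) λ ()
    edge (inj₂ y) (inj₂ y′) e =
      contradiction (subst₂ (λ p q → p xor q ≡ true) (side-↑ʳ a y) (side-↑ʳ a y′) e) λ ()

∈-N⁻ : ∀ {n} (G : Graph n) {u v} → u ∈ N G v → E G v u ≡ true
∈-N⁻ G {u} {v} u∈ = trans (sym (lookup∘tabulate (E G v) u)) ([]=⇒lookup u∈)

module _ {n} (G : Graph n) (Is It : Subset n) where

  attachment : Fin n → Subset n
  attachment v = N G v ∩ X G Is It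

  ∈-C3⁻ : ∀ {v} → v ∈ᴸ C3 G Is It → v ∉ X G Is It × 3 ≤ ∣ attachment v ∣
  ∈-C3⁻ = proj₂ ∘ ∈-filter⁻ (λ v → ¬? (v ∈? X G Is It) ×-dec (3 ≤? ∣ attachment v ∣)) {xs = allFin n}

  attachment∈Ys3 : ∀ {v} → v ∈ᴸ C3 G Is It → attachment v ∈ᴸ Ys3 G Is It
  attachment∈Ys3 {v} v∈C3 with ∈-C3⁻ v∈C3
  ... | v∉X , three≤ =
    ∈-filter⁺ (λ Y → (Y ⊆? X G Is It) ×-dec (3 ≤? ∣ Y ∣) ×-dec any? (inC? G Is It Y))
      (allSubsets-complete (attachment v))
      (p∩q⊆q (N G v) (X G Is It) , three≤ , v , v∉X , refl)

  ∈-Ys3⇒3≤∣Y∣ : ∀ {Y} → Y ∈ᴸ Ys3 G Is It → 3 ≤ ∣ Y ∣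
  ∈-Ys3⇒3≤∣Y∣ Y∈ =
    proj₁ (proj₂ (proj₂ (∈-filter⁻ (λ Y → (Y ⊆? X G Is It) ×-dec (3 ≤? ∣ Y ∣) ×-dec any? (inC? G Is It Y))
                                   {xs = allSubsets n} Y∈)))

  -- The class C_Y for |Y| ≥ 3, and empty for smaller Y.
  C : Subset n → List (Fin n)
  C Y = fibre (≡-dec _≟ᵇ_) attachment Y (C3 G Is It)

  ∈-C⁻ : ∀ {Y v} → v ∈ᴸ C Y → v ∉ X G Is It × attachment v ≡ Y
  ∈-C⁻ v∈ with ∈-filter⁻ (λ v → ≡-dec _≟ᵇ_ (attachment v) _) {xs = C3 G Is It} v∈
  ... | v∈C3 , attached = proj₁ (∈-C3⁻ v∈C3) , attached

  C-unique : ∀ Y → Unique (C Y)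
  C-unique Y = Unique.filter⁺ _ (Unique.filter⁺ _ (Unique.allFin⁺ n))

  large-C⇒K3r-minor : ∀ {Y} r → 3 ≤ ∣ Y ∣ → r ≤ length (C Y) → HasMinor G (K 3 r)
  large-C⇒K3r-minor {Y} r 3≤∣Y∣ r≤∣C∣
    with distinct-elements 3 (elements Y) (elements-unique Y)
           (subst (3 ≤_) (sym (length-elements Y)) 3≤∣Y∣)
       | distinct-elements r (C Y) (C-unique Y) r≤∣C∣
  ... | a , a-inj , a∈ | c , c-inj , c∈ = biclique⇒minor G a c a-inj c-inj a≢c adj
    where
      a∈attachment : ∀ x y → a x ∈ attachment (c y)
      a∈attachment x y = subst (a x ∈_) (sym (proj₂ (∈-C⁻ (c∈ y)))) (∈-elements⁻ Y (a∈ x))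
      a≢c : ∀ x y → a x ≢ c y
      a≢c x y a≡c = proj₁ (∈-C⁻ (c∈ y))
                      (subst (_∈ X G Is It) a≡c (p∩q⊆q (N G (c y)) (X G Is It) (a∈attachment x y)))
      adj : ∀ x y → E G (a x) (c y) ≡ true
      adj x y = trans (Graph.sym G (a x) (c y))
                      (∈-N⁻ G (p∩q⊆p (N G (c y)) (X G Is It) (a∈attachment x y)))

  C-bound : ∀ r → MinorFree G (K 3 r) → ∀ {Y} → Y ∈ᴸ Ys3 G Is It → length (C Y) < r
  C-bound r K3r-free {Y} Y∈ with length (C Y) <? r
  ... | yes ∣C∣<r = ∣C∣<r
  ... | no ∣C∣≮r  = contradiction (large-C⇒K3r-minor r (∈-Ys3⇒3≤∣Y∣ Y∈) (≮⇒≥ ∣C∣≮r)) K3r-free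

mainTheorem4 : ∀ {n} (G : Graph n) (r : ℕ) → 1 ≤ r → MinorFree G (K 3 r) →
               ∀ (k : ℕ) (Is It : Subset n) →
               Independent G Is → Independent G It →
               ∣ Is ∣ ≡ k → ∣ It ∣ ≡ k →
               length (C3 G Is It) ≤ (r ∸ 1) * N3 G Is It
mainTheorem4 G r _ K3r-free _ Is It _ _ _ _ =
  pigeonhole (≡-dec _≟ᵇ_) (attachment G Is It) (r ∸ 1) (Ys3 G Is It) (C3 G Is It)
    (attachment∈Ys3 G Is It)
    (λ Y∈ → ∸-monoˡ-≤ 1 (C-bound G Is It r K3r-free Y∈))
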